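{- (Induction rule.) Let $\otimes$ be a merge and $A(\vec x,y)$ a formula of $\mathcal{L}_1$ with free variables among $\vec x,y$. Let $r$ assign to each vector $\vec\alpha$ of individuals an interactive realizer $r(\vec\alpha)$ and $r'$ assign to each $\vec\alpha,\beta$ of individuals an interactive realizer $r'(\vec\alpha,\beta)$, such that for all individuals $\vec\alpha,\beta$ in $\mathcal{S}\mathbb{N}$: $r(\vec\alpha)\Vdash\vec\alpha:A(\vec x,0)$ and $r'(\vec\alpha,\beta)\Vdash\vec\alpha,\beta:A(\vec x,y)\rightarrow A(\vec x,\mathsf{succ}(y))$. For each $\vec\alpha$ define $f(\vec\alpha):\mathbb{N}\to\mathcal{S}\mathbb{S}$ by $f(\vec\alpha,0)=\lambda\_.\bot$ and $f(\vec\alpha,n+1)=f(\vec\alpha,n)\otimes^{\mathcal{S}}r'(\vec\alpha,\lambda\_.n)$, and let $f(\vec\alpha)^{*}(\beta)=\lambda s.\,f(\vec\alpha,\beta(s))(s)$. Then for all individuals $\vec\alpha,\beta$, $f(\vec\alpha)^{*}(\beta)$ is an interactive realizer and $r(\vec\alpha)\otimes^{\mathcal{S}}f(\vec\alpha)^{*}(\beta)\Vdash\vec\alpha,\beta:A(\vec x,y)$.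
   Context: $\mathcal{L}_1$: quantifier-free language of primitive recursive arithmetic (variables, $0$, $\mathsf{succ}$, symbols for primitive recursive functions and predicates, $=$, $\neg,\wedge,\vee,\rightarrow$) extended with, for each $(k+1)$-ary predicate symbol $P$, a $k$-ary function symbol $\varphi_P$ and $k$-ary predicate symbol $\chi_P$. A state is a finite set $s$ of triples $\langle P,\vec m,n\rangle$ with $P(\vec m,n)$ true in the standard model and at most one $n$ per $(P,\vec m)$; $\mathbb{S}$ the set of states, ordered by inclusion $\sqsubseteq$, $\bot=\emptyset$; compatible states have a state as union. $\mathcal{S}X=\mathbb{S}\to X$. Interpretation under an environment $\xi:\mathrm{Var}\to\mathcal{S}\mathbb{N}$: $[\![x]\!]_\xi=\xi(x)$, $[\![0]\!]_\xi=\lambda s.0$, $\mathcal{L}_0$-symbols pointwise with standard meaning, $[\![\varphi_P(\vec t)]\!]_\xi(s)=[\![\varphi_P]\!]([\![\vec t]\!]_\xi(s),s)$ where $[\![\varphi_P]\!](\vec m,s)=n$ if $\langle P,\vec m,n\rangle\in s$ else $0$, $[\![\chi_P(\vec t)]\!]_\xi(s)=\mathsf{true}$ iff some $\langle P,[\![\vec t]\!]_\xi(s),n\rangle\in s$, connectives pointwise. An individual is $\alpha\in\mathcal{S}X$ such that $\alpha(\sigma(i))$ is eventually constant for every $\sigma:\mathbb{N}\to\mathbb{S}$ with $\sigma(i)\sqsubseteq\sigma(j)$ for $i\le j$. A merge is $\otimes:\mathbb{S}\times\mathbb{S}\to\mathbb{S}$ making $(\mathbb{S},\otimes,\bot)$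 a monoid, with $s_1\otimes s_2=\bot\Rightarrow s_1=s_2=\bot$ and $s_1\otimes s_2\subseteq s_1\cup s_2$; $(r\otimes^{\mathcal{S}}r')(s)=r(s)\otimes r'(s)$. An interactive realizer is an individual $r\in\mathcal{S}\mathbb{S}$ with $r(s)$ compatible with $s$ and $r(s)\cap s=\emptyset$; $\mathrm{Prefix}(r)=\{s\mid r(s)\sqsubseteq s\}$. For $A$ with free variables among $z_1,\ldots,z_k$ and $\vec\gamma\in(\mathcal{S}\mathbb{N})^k$, $r\Vdash\vec\gamma:A$ means $[\![A]\!]_{[\lambda\_.\gamma_i(s)/z_i]}(s)=\mathsf{true}$ for every $s\in\mathrm{Prefix}(r)$. -}

module Defs where

open import Data.Nat using (ℕ; zero; suc; _≤_; _≡ᵇ_)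
open import Data.Bool using (Bool; true; false; not; _∧_; _∨_; if_then_else_)
open import Data.Fin using (Fin; toℕ) renaming (zero to fzero; suc to fsuc)
open import Data.Vec using (Vec; []; _∷_; _∷ʳ_; lookup)
open import Data.List using (List; []; _∷_; _++_)
open import Data.List.Membership.Propositional using (_∈_)
open import Data.Maybe using (Maybe; just; nothing; is-just; fromMaybe)
open import Data.Product using (Σ; ∃; _×_; _,_)
open import Data.Empty using (⊥)
open import Relation.Binary.PropositionalEquality using (_≡_; _≢_)

-- L0: codes for primitive recursive functions (of a given arity).
-- A primitive recursive predicate symbol of arity k is a code f : PR k,
-- the predicate being true at xs iff  eval f xs ≢ 0.

mutual
  data PR : ℕ → Set where
    Zᵖ : ∀ {n} → PR n
    Sᵖ : PR 1
    Pᵖ : ∀ {n} → Fin n → PR n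
    Cᵖ : ∀ {n m} → PR m → PRs n m → PR n
    Rᵖ : ∀ {n} → PR n → PR (suc (suc n)) → PR (suc n)

  data PRs (n : ℕ) : ℕ → Set where
    []  : PRs n 0
    _∷_ : ∀ {m} → PR n → PRs n m → PRs n (suc m)

mutual
  eval : ∀ {n} → PR n → Vec ℕ n → ℕ
  eval Zᵖ xs = 0
  eval Sᵖ (x ∷ []) = suc x
  eval (Pᵖ i) xs = lookup xs i
  eval (Cᵖ f gs) xs = eval f (evals gs xs)
  eval (Rᵖ g h) (zero ∷ xs) = eval g xs
  eval (Rᵖ g h) (suc x ∷ xs) = eval h (eval (Rᵖ g h) (x ∷ xs) ∷ x ∷ xs)

  evals : ∀ {n m} → PRs n m → Vec ℕ n → Vec ℕ m
  evals [] xs = []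
  evals (g ∷ gs) xs = eval g xs ∷ evals gs xs

mutual
  eqPR : ∀ {n m} → PR n → PR m → Bool
  eqPR (Zᵖ {n}) (Zᵖ {m}) = n ≡ᵇ m
  eqPR Sᵖ Sᵖ = true
  eqPR (Pᵖ {n} i) (Pᵖ {m} j) = (n ≡ᵇ m) ∧ (toℕ i ≡ᵇ toℕ j)
  eqPR (Cᵖ {n} f gs) (Cᵖ {n'} f' gs') = (n ≡ᵇ n') ∧ (eqPR f f' ∧ eqPRs gs gs')
  eqPR (Rᵖ g h) (Rᵖ g' h') = eqPR g g' ∧ eqPR h h'
  eqPR _ _ = false

  eqPRs : ∀ {n m n' m'} → PRs n m → PRs n' m' → Bool
  eqPRs [] [] = true
  eqPRs (g ∷ gs) (g' ∷ gs') = eqPR g g' ∧ eqPRs gs gs'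
  eqPRs _ _ = false

eqVec : ∀ {n m} → Vec ℕ n → Vec ℕ m → Bool
eqVec [] [] = true
eqVec (x ∷ xs) (y ∷ ys) = (x ≡ᵇ y) ∧ eqVec xs ys
eqVec _ _ = false

record Triple : Set where
  constructor ⟨_,_,_⟩
  field
    {ar}  : ℕ
    sym   : PR (suc ar)
    args  : Vec ℕ ar
    val   : ℕ
open Triple public

TrueTriple : Triple → Set
TrueTriple t = eval (sym t) (args t ∷ʳ val t) ≢ 0

Functional : List Triple → Set
Functional l = ∀ {k} (P : PR (suc k)) (ms : Vec ℕ k) (n n' : ℕ) →
  ⟨ P , ms , n ⟩ ∈ l → ⟨ P , ms , n' ⟩ ∈ l → n ≡ n'

record 𝕊 : Set where
  field
    elems      : List Triple
    allTrue    : ∀ {t} → t ∈ elems → TrueTriple t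
    functional : Functional elems
open 𝕊 public

⊥𝕊 : 𝕊
⊥𝕊 = record { elems = [] ; allTrue = λ () ; functional = λ _ _ _ _ () }

_⊑_ : 𝕊 → 𝕊 → Set
s ⊑ s' = ∀ {t} → t ∈ elems s → t ∈ elems s'

_≈_ : 𝕊 → 𝕊 → Set
s ≈ s' = (s ⊑ s') × (s' ⊑ s)

_⊆∪_ : 𝕊 → 𝕊 × 𝕊 → Set
s ⊆∪ (s₁ , s₂) = ∀ {t} → t ∈ elems s → t ∈ (elems s₁ ++ elems s₂)

-- compatible: the union is again a state (truth of triples is automatic)
Compatible : 𝕊 → 𝕊 → Set
Compatible s s' = Functional (elems s ++ elems s')

Disjoint : 𝕊 → 𝕊 → Set
Disjoint s s' = ∀ {t} → t ∈ elems s → t ∈ elems s' → ⊥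

𝒮 : Set → Set
𝒮 X = 𝕊 → X

Chain : (ℕ → 𝕊) → Set
Chain σ = ∀ i j → i ≤ j → σ i ⊑ σ j

-- individuals of 𝒮ℕ (functions on states = functions on finite sets,
-- hence invariant under ≈)
Individualℕ : 𝒮 ℕ → Set
Individualℕ α =
  (∀ s s' → s ≈ s' → α s ≡ α s') ×
  (∀ σ → Chain σ → ∃ λ N → ∀ i → N ≤ i → α (σ i) ≡ α (σ N))

Individual𝕊 : 𝒮 𝕊 → Set
Individual𝕊 α =
  (∀ s s' → s ≈ s' → α s ≈ α s') ×
  (∀ σ → Chain σ → ∃ λ N → ∀ i → N ≤ i → α (σ i) ≈ α (σ N))

record Merge : Set where
  field
    _⊗_       : 𝕊 → 𝕊 → 𝕊
    ⊗-cong    : ∀ {s₁ s₁' s₂ s₂'} → s₁ ≈ s₁' → s₂ ≈ s₂' → (s₁ ⊗ s₂) ≈ (s₁' ⊗ s₂')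
    assoc     : ∀ s₁ s₂ s₃ → ((s₁ ⊗ s₂) ⊗ s₃) ≈ (s₁ ⊗ (s₂ ⊗ s₃))
    identityˡ : ∀ s → (⊥𝕊 ⊗ s) ≈ s
    identityʳ : ∀ s → (s ⊗ ⊥𝕊) ≈ s
    zeroSum   : ∀ s₁ s₂ → (s₁ ⊗ s₂) ≈ ⊥𝕊 → (s₁ ≈ ⊥𝕊) × (s₂ ≈ ⊥𝕊)
    ⊗-⊆-∪     : ∀ s₁ s₂ → (s₁ ⊗ s₂) ⊆∪ (s₁ , s₂)

_⊗ˢ[_]_ : 𝒮 𝕊 → Merge → 𝒮 𝕊 → 𝒮 𝕊
(r ⊗ˢ[ M ] r') s = Merge._⊗_ M (r s) (r' s)

InteractiveRealizer : 𝒮 𝕊 → Set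
InteractiveRealizer r =
  Individual𝕊 r × (∀ s → Compatible (r s) s) × (∀ s → Disjoint (r s) s)

Prefix : 𝒮 𝕊 → 𝕊 → Set
Prefix r s = r s ⊑ s

data Term (v : ℕ) : Set where
  var  : Fin v → Term v
  zer  : Term v
  sucᵗ : Term v → Term v
  fn   : ∀ {k} → PR k → Vec (Term v) k → Term v
  φ    : ∀ {k} → PR (suc k) → Vec (Term v) k → Term v

data Formula (v : ℕ) : Set where
  _≐_  : Term v → Term v → Formula v
  rel  : ∀ {k} → PR k → Vec (Term v) k → Formula v
  χ    : ∀ {k} → PR (suc k) → Vec (Term v) k → Formula v
  ¬ᶠ_  : Formula v → Formula v
  _∧ᶠ_ : Formula v → Formula v → Formula v
  _∨ᶠ_ : Formula v → Formula v → Formula v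
  _⇒ᶠ_ : Formula v → Formula v → Formula v

mutual
  subT : ∀ {v w} → (Fin v → Term w) → Term v → Term w
  subT σ (var i) = σ i
  subT σ zer = zer
  subT σ (sucᵗ t) = sucᵗ (subT σ t)
  subT σ (fn f ts) = fn f (subTs σ ts)
  subT σ (φ P ts) = φ P (subTs σ ts)

  subTs : ∀ {v w k} → (Fin v → Term w) → Vec (Term v) k → Vec (Term w) k
  subTs σ [] = []
  subTs σ (t ∷ ts) = subT σ t ∷ subTs σ ts

subF : ∀ {v w} → (Fin v → Term w) → Formula v → Formula w
subF σ (t ≐ u) = subT σ t ≐ subT σ u
subF σ (rel p ts) = rel p (subTs σ ts)
subF σ (χ P ts) = χ P (subTs σ ts)
subF σ (¬ᶠ A) = ¬ᶠ subF σ A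
subF σ (A ∧ᶠ B) = subF σ A ∧ᶠ subF σ B
subF σ (A ∨ᶠ B) = subF σ A ∨ᶠ subF σ B
subF σ (A ⇒ᶠ B) = subF σ A ⇒ᶠ subF σ B

lookupTriple : ∀ {k} → PR (suc k) → Vec ℕ k → List Triple → Maybe ℕ
lookupTriple P ms [] = nothing
lookupTriple P ms (t ∷ l) =
  if eqPR P (sym t) ∧ eqVec ms (args t) then just (val t) else lookupTriple P ms l

⟦φ⟧ : ∀ {k} → PR (suc k) → Vec ℕ k → 𝕊 → ℕ
⟦φ⟧ P ms s = fromMaybe 0 (lookupTriple P ms (elems s))

⟦χ⟧ : ∀ {k} → PR (suc k) → Vec ℕ k → 𝕊 → Bool
⟦χ⟧ P ms s = is-just (lookupTriple P ms (elems s))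

Env : ℕ → Set
Env v = Fin v → 𝒮 ℕ

mutual
  ⟦_⟧ᵗ : ∀ {v} → Term v → Env v → 𝒮 ℕ
  ⟦ var i ⟧ᵗ ξ = ξ i
  ⟦ zer ⟧ᵗ ξ = λ _ → 0
  ⟦ sucᵗ t ⟧ᵗ ξ = λ s → suc (⟦ t ⟧ᵗ ξ s)
  ⟦ fn f ts ⟧ᵗ ξ = λ s → eval f (⟦ ts ⟧ᵗˢ ξ s)
  ⟦ φ P ts ⟧ᵗ ξ = λ s → ⟦φ⟧ P (⟦ ts ⟧ᵗˢ ξ s) s

  ⟦_⟧ᵗˢ : ∀ {v k} → Vec (Term v) k → Env v → 𝕊 → Vec ℕ k
  ⟦ [] ⟧ᵗˢ ξ s = []
  ⟦ t ∷ ts ⟧ᵗˢ ξ s = ⟦ t ⟧ᵗ ξ s ∷ ⟦ ts ⟧ᵗˢ ξ s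

⟦_⟧ᶠ : ∀ {v} → Formula v → Env v → 𝒮 Bool
⟦ t ≐ u ⟧ᶠ ξ s = ⟦ t ⟧ᵗ ξ s ≡ᵇ ⟦ u ⟧ᵗ ξ s
⟦ rel p ts ⟧ᶠ ξ s = not (eval p (⟦ ts ⟧ᵗˢ ξ s) ≡ᵇ 0)
⟦ χ P ts ⟧ᶠ ξ s = ⟦χ⟧ P (⟦ ts ⟧ᵗˢ ξ s) s
⟦ ¬ᶠ A ⟧ᶠ ξ s = not (⟦ A ⟧ᶠ ξ s)
⟦ A ∧ᶠ B ⟧ᶠ ξ s = ⟦ A ⟧ᶠ ξ s ∧ ⟦ B ⟧ᶠ ξ s
⟦ A ∨ᶠ B ⟧ᶠ ξ s = ⟦ A ⟧ᶠ ξ s ∨ ⟦ B ⟧ᶠ ξ s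
⟦ A ⇒ᶠ B ⟧ᶠ ξ s = not (⟦ A ⟧ᶠ ξ s) ∨ ⟦ B ⟧ᶠ ξ s

_⊩_∶_ : ∀ {v} → 𝒮 𝕊 → (Fin v → 𝒮 ℕ) → Formula v → Set
r ⊩ γ ∶ A = ∀ s → Prefix r s → ⟦ A ⟧ᶠ (λ i → λ _ → γ i s) s ≡ true

-- The induction rule: variables of A(x⃗, y) are Fin (suc k),
-- with y = fzero and x_i = fsuc i.

env : ∀ {k} → (Fin k → 𝒮 ℕ) → 𝒮 ℕ → Fin (suc k) → 𝒮 ℕ
env αs β fzero = β
env αs β (fsuc i) = αs i

A[y≔0] : ∀ {k} → Formula (suc k) → Formula k
A[y≔0] = subF λ { fzero → zer ; (fsuc i) → var i }

A[y≔succy] : ∀ {k} → Formula (suc k) → Formula (suc k)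
A[y≔succy] = subF λ { fzero → sucᵗ (var fzero) ; (fsuc i) → var (fsuc i) }

fseq : ∀ {k} → Merge → ((Fin k → 𝒮 ℕ) → 𝒮 ℕ → 𝒮 𝕊) → (Fin k → 𝒮 ℕ) → ℕ → 𝒮 𝕊
fseq M r' αs zero = λ _ → ⊥𝕊
fseq M r' αs (suc n) = fseq M r' αs n ⊗ˢ[ M ] r' αs (λ _ → n)

fstar : ∀ {k} → Merge → ((Fin k → 𝒮 ℕ) → 𝒮 ℕ → 𝒮 𝕊) → (Fin k → 𝒮 ℕ) → 𝒮 ℕ → 𝒮 𝕊
fstar M r' αs β = λ s → fseq M r' αs (β s) s

module Submission where

-- Write f n = fseq M r' αs n, so f (n+1) = f n ⊗ R n with R n = r'(αs, λ_.n),
-- and F = f(αs)*(β) is the "diagonal" s ↦ f (β s) s.  The proof has two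
-- independent halves.
--
-- Realizer half: interactive realizers contain the constant ⊥ and are closed
-- under the pointwise merge ⊗ˢ (a merge only keeps triples of its arguments,
-- so compatibility with s and disjointness from s survive), hence every f n is
-- one; and the diagonal of a family of interactive realizers along an
-- individual β is again one (β stabilises along a chain, then f (β _) does).
--
-- Truth half: a state s that is a prefix of a merge of interactive realizers
-- is a prefix of both arguments, since a merge that is disjoint from s but
-- contained in s is ⊥, and ⊥ only splits as ⊥ ⊗ ⊥.  So a prefix of
-- r αs ⊗ˢ F is a prefix of r αs and of every R n with n < β s; the base
-- realizer gives A(αs, 0) at s and the step realizers carry A(αs, n) to
-- A(αs, n+1) at s, up to n = β s.

open import Defs hiding (sym)
open import Data.Nat using (ℕ; zero; suc; _≤_; _⊔_; _≡ᵇ_)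
open import Data.Nat.Properties using (m≤m⊔n; m≤n⊔m; ≤-trans)
open import Data.Fin using (Fin) renaming (zero to fzero; suc to fsuc)
open import Data.Product using (_×_; _,_; proj₁; proj₂; ∃)
open import Data.Sum using (inj₁; inj₂)
open import Data.Bool using (true; not; _∧_; _∨_)
open import Data.Vec using (Vec; []; _∷_)
open import Data.List.Membership.Propositional using (_∈_)
open import Data.List.Membership.Propositional.Properties using (∈-++⁺ˡ; ∈-++⁺ʳ; ∈-++⁻)
open import Data.Empty using (⊥-elim)
open import Level using (0ℓ)
open import Relation.Binary.Bundles using (Setoid)
open import Relation.Binary.PropositionalEquality using (_≡_; refl; sym; trans; cong; cong₂)
import Relation.Binary.Reasoning.Setoid as SetoidReasoning

Holds : ∀ {v} → Formula v → (Fin v → 𝒮 ℕ) → 𝕊 → Set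
Holds A γ s = ⟦ A ⟧ᶠ (λ i _ → γ i s) s ≡ true

module Substitution {v w} (σ : Fin v → Term w) (ξ : Env w) (ξ' : Env v) (s : 𝕊)
  (agree : ∀ i → ξ' i s ≡ ⟦ σ i ⟧ᵗ ξ s) where

  mutual
    subT-sound : ∀ t → ⟦ subT σ t ⟧ᵗ ξ s ≡ ⟦ t ⟧ᵗ ξ' s
    subT-sound (var i) = sym (agree i)
    subT-sound zer = refl
    subT-sound (sucᵗ t) = cong suc (subT-sound t)
    subT-sound (fn f ts) = cong (eval f) (subTs-sound ts)
    subT-sound (φ P ts) = cong (λ ms → ⟦φ⟧ P ms s) (subTs-sound ts)

    subTs-sound : ∀ {k} (ts : Vec (Term v) k) → ⟦ subTs σ ts ⟧ᵗˢ ξ s ≡ ⟦ ts ⟧ᵗˢ ξ' s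
    subTs-sound [] = refl
    subTs-sound (t ∷ ts) = cong₂ _∷_ (subT-sound t) (subTs-sound ts)

  subF-sound : ∀ A → ⟦ subF σ A ⟧ᶠ ξ s ≡ ⟦ A ⟧ᶠ ξ' s
  subF-sound (t ≐ u) = cong₂ _≡ᵇ_ (subT-sound t) (subT-sound u)
  subF-sound (rel p ts) = cong (λ ms → not (eval p ms ≡ᵇ 0)) (subTs-sound ts)
  subF-sound (χ P ts) = cong (λ ms → ⟦χ⟧ P ms s) (subTs-sound ts)
  subF-sound (¬ᶠ A) = cong not (subF-sound A)
  subF-sound (A ∧ᶠ B) = cong₂ _∧_ (subF-sound A) (subF-sound B)
  subF-sound (A ∨ᶠ B) = cong₂ _∨_ (subF-sound A) (subF-sound B)
  subF-sound (A ⇒ᶠ B) = cong₂ (λ a b → not a ∨ b) (subF-sound A) (subF-sound B)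

holds-local : ∀ {v} (A : Formula v) (γ γ' : Fin v → 𝒮 ℕ) {s} →
  (∀ i → γ i s ≡ γ' i s) → Holds A γ s → Holds A γ' s
holds-local A γ γ' {s} agree holds =
  trans (sym (Substitution.subF-sound var ξ ξ' s (λ i → sym (agree i)) A))
        (trans (Substitution.subF-sound var ξ ξ s (λ _ → refl) A) holds)
  where
  ξ ξ' : Env _
  ξ i _ = γ i s
  ξ' i _ = γ' i s

holds-⇒ : ∀ {v} (A B : Formula v) γ {s} → Holds (A ⇒ᶠ B) γ s → Holds A γ s → Holds B γ s
holds-⇒ A B γ holdsAB holdsA = implication holdsAB holdsA
  where
  implication : ∀ {a b} → not a ∨ b ≡ true → a ≡ true → b ≡ true
  implication a⇒b refl = a⇒b

at : ∀ {k} → (Fin k → 𝒮 ℕ) → ℕ → Fin (suc k) → 𝒮 ℕ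
at αs n = env αs (λ _ → n)

holds-A[y≔0] : ∀ {k} (A : Formula (suc k)) αs s →
  Holds (A[y≔0] A) αs s → Holds A (at αs 0) s
holds-A[y≔0] A αs s holds =
  trans (sym (Substitution.subF-sound _ (λ i _ → αs i s) (λ i _ → at αs 0 i s) s
                (λ { fzero → refl ; (fsuc i) → refl }) A))
        holds

holds-A[y≔succy] : ∀ {k} (A : Formula (suc k)) αs n s →
  Holds (A[y≔succy] A) (at αs n) s → Holds A (at αs (suc n)) s
holds-A[y≔succy] A αs n s holds =
  trans (sym (Substitution.subF-sound _ (λ i _ → at αs n i s) (λ i _ → at αs (suc n) i s) s
                (λ { fzero → refl ; (fsuc i) → refl }) A))
        holds

≈-setoid : Setoid 0ℓ 0ℓ
≈-setoid = record
  { Carrier = 𝕊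
  ; _≈_ = _≈_
  ; isEquivalence = record
    { refl = (λ x → x) , (λ x → x)
    ; sym = λ (p , q) → q , p
    ; trans = λ (p , q) (p' , q') → (λ x → p' (p x)) , (λ x → q (q' x))
    }
  }

open Setoid ≈-setoid using () renaming (refl to ≈-refl; sym to ≈-sym; trans to ≈-trans)

disjoint-prefix⇒⊥ : ∀ {a s} → Disjoint a s → a ⊑ s → a ≈ ⊥𝕊
disjoint-prefix⇒⊥ disj sub = (λ x → ⊥-elim (disj x (sub x))) , (λ ())

⊥⇒prefix : ∀ {a s} → a ≈ ⊥𝕊 → a ⊑ s
⊥⇒prefix a≈⊥ x with proj₁ a≈⊥ x
... | ()

StableFrom : (ℕ → 𝕊) → ℕ → Set
StableFrom x N = ∀ i → N ≤ i → x i ≈ x N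

stableFrom-mono : ∀ {x N N'} → StableFrom x N → N ≤ N' → StableFrom x N'
stableFrom-mono {x} {N} {N'} stable N≤N' i N'≤i =
  ≈-trans {x i} {x N} {x N'} (stable i (≤-trans N≤N' N'≤i)) (≈-sym {x N'} {x N} (stable N' N≤N'))

const-individualℕ : ∀ n → Individualℕ (λ _ → n)
const-individualℕ n = (λ _ _ _ → refl) , (λ _ _ → 0 , λ _ _ → refl)

const-individual𝕊 : ∀ a → Individual𝕊 (λ _ → a)
const-individual𝕊 a = (λ _ _ _ → ≈-refl {a}) , (λ _ _ → 0 , λ _ _ → ≈-refl {a})

⊗ˢ-individual : ∀ M {a b} → Individual𝕊 a → Individual𝕊 b → Individual𝕊 (a ⊗ˢ[ M ] b)
⊗ˢ-individual M {a} {b} (a-inv , a-conv) (b-inv , b-conv) = inv , conv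
  where
  open Merge M
  inv : ∀ s s' → s ≈ s' → (a ⊗ˢ[ M ] b) s ≈ (a ⊗ˢ[ M ] b) s'
  inv s s' s≈s' = ⊗-cong (a-inv s s' s≈s') (b-inv s s' s≈s')
  conv : ∀ σ → Chain σ → ∃ λ N → StableFrom (λ i → (a ⊗ˢ[ M ] b) (σ i)) N
  conv σ chain with a-conv σ chain | b-conv σ chain
  ... | Na , a-stable | Nb , b-stable = Na ⊔ Nb , λ i le →
    ⊗-cong (stableFrom-mono {λ j → a (σ j)} a-stable (m≤m⊔n Na Nb) i le)
           (stableFrom-mono {λ j → b (σ j)} b-stable (m≤n⊔m Na Nb) i le)

diagonal : (ℕ → 𝒮 𝕊) → 𝒮 ℕ → 𝒮 𝕊
diagonal f β s = f (β s) s

-- Along a chain, β settles on some value m, and then f m settles too.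
diagonal-individual : ∀ f β → (∀ n → Individual𝕊 (f n)) → Individualℕ β →
  Individual𝕊 (diagonal f β)
diagonal-individual f β f-ind (β-inv , β-conv) = inv , conv
  where
  open SetoidReasoning ≈-setoid
  inv : ∀ s s' → s ≈ s' → diagonal f β s ≈ diagonal f β s'
  inv s s' s≈s' = begin
    f (β s) s   ≈⟨ proj₁ (f-ind (β s)) s s' s≈s' ⟩
    f (β s) s'  ≡⟨ cong (λ n → f n s') (β-inv s s' s≈s') ⟩
    f (β s') s' ∎
  conv : ∀ σ → Chain σ → ∃ λ N → StableFrom (λ i → diagonal f β (σ i)) N
  conv σ chain with β-conv σ chain
  ... | Nβ , β-stable with proj₂ (f-ind (β (σ Nβ))) σ chain
  ... | Nf , f-stable = N , stable
    where
    N = Nβ ⊔ Nf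
    m = β (σ Nβ)
    stable : StableFrom (λ i → diagonal f β (σ i)) N
    stable i N≤i = begin
      f (β (σ i)) (σ i) ≡⟨ cong (λ n → f n (σ i)) (β-stable i (≤-trans (m≤m⊔n Nβ Nf) N≤i)) ⟩
      f m (σ i)         ≈⟨ stableFrom-mono {λ j → f m (σ j)} f-stable (m≤n⊔m Nβ Nf) i N≤i ⟩
      f m (σ N)         ≡⟨ cong (λ n → f n (σ N)) (sym (β-stable N (m≤m⊔n Nβ Nf))) ⟩
      f (β (σ N)) (σ N) ∎

CrossCompatible : 𝕊 → 𝕊 → Set
CrossCompatible a s = ∀ {k} (P : PR (suc k)) (ms : Vec ℕ k) (n n' : ℕ) →
  ⟨ P , ms , n ⟩ ∈ elems a → ⟨ P , ms , n' ⟩ ∈ elems s → n ≡ n'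

compatible⇒cross : ∀ a s → Compatible a s → CrossCompatible a s
compatible⇒cross a s compat P ms n n' x y = compat P ms n n' (∈-++⁺ˡ x) (∈-++⁺ʳ (elems a) y)

-- Two states are compatible as soon as they agree on their common keys,
-- since each of them is functional on its own.
cross⇒compatible : ∀ a s → CrossCompatible a s → Compatible a s
cross⇒compatible a s cross P ms n n' x y with ∈-++⁻ (elems a) x | ∈-++⁻ (elems a) y
... | inj₁ x∈a | inj₁ y∈a = functional a P ms n n' x∈a y∈a
... | inj₁ x∈a | inj₂ y∈s = cross P ms n n' x∈a y∈s
... | inj₂ x∈s | inj₁ y∈a = sym (cross P ms n' n y∈a x∈s)
... | inj₂ x∈s | inj₂ y∈s = functional s P ms n n' x∈s y∈s

-- A merge only contains triples of its arguments, so it inherits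
-- compatibility with and disjointness from s.
⊗-compatible : ∀ M a b s → Compatible a s → Compatible b s → Compatible (Merge._⊗_ M a b) s
⊗-compatible M a b s a-compat b-compat =
  cross⇒compatible (Merge._⊗_ M a b) s cross
  where
  cross : CrossCompatible (Merge._⊗_ M a b) s
  cross P ms n n' x y with ∈-++⁻ (elems a) (Merge.⊗-⊆-∪ M a b x)
  ... | inj₁ x∈a = compatible⇒cross a s a-compat P ms n n' x∈a y
  ... | inj₂ x∈b = compatible⇒cross b s b-compat P ms n n' x∈b y

⊗-disjoint : ∀ M a b s → Disjoint a s → Disjoint b s → Disjoint (Merge._⊗_ M a b) s
⊗-disjoint M a b s a-disj b-disj x y with ∈-++⁻ (elems a) (Merge.⊗-⊆-∪ M a b x)
... | inj₁ x∈a = a-disj x∈a y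
... | inj₂ x∈b = b-disj x∈b y

⊥-realizer : InteractiveRealizer (λ _ → ⊥𝕊)
⊥-realizer = const-individual𝕊 ⊥𝕊 , (λ s → functional s) , (λ _ ())

⊗ˢ-realizer : ∀ M {a b} → InteractiveRealizer a → InteractiveRealizer b →
  InteractiveRealizer (a ⊗ˢ[ M ] b)
⊗ˢ-realizer M {a} {b} (a-ind , a-compat , a-disj) (b-ind , b-compat , b-disj) =
  ⊗ˢ-individual M a-ind b-ind ,
  (λ s → ⊗-compatible M (a s) (b s) s (a-compat s) (b-compat s)) ,
  (λ s → ⊗-disjoint M (a s) (b s) s (a-disj s) (b-disj s))

diagonal-realizer : ∀ f β → (∀ n → InteractiveRealizer (f n)) → Individualℕ β →
  InteractiveRealizer (diagonal f β)
diagonal-realizer f β f-real β-ind =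
  diagonal-individual f β (λ n → proj₁ (f-real n)) β-ind ,
  (λ s → proj₁ (proj₂ (f-real (β s))) s) ,
  (λ s → proj₂ (proj₂ (f-real (β s))) s)

-- A prefix of a merge of interactive realizers is a prefix of both:
-- the merged state is ⊥, and ⊥ only splits as ⊥ ⊗ ⊥.
prefix-⊗ : ∀ M a b → InteractiveRealizer a → InteractiveRealizer b →
  ∀ s → Prefix (a ⊗ˢ[ M ] b) s → Prefix a s × Prefix b s
prefix-⊗ M a b (_ , _ , a-disj) (_ , _ , b-disj) s prefix
  with Merge.zeroSum M (a s) (b s)
         (disjoint-prefix⇒⊥ {(a ⊗ˢ[ M ] b) s} {s} (⊗-disjoint M (a s) (b s) s (a-disj s) (b-disj s)) prefix)
... | a≈⊥ , b≈⊥ = ⊥⇒prefix {a s} {s} a≈⊥ , ⊥⇒prefix {b s} {s} b≈⊥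

module InductionRule (M : Merge) {k} (A : Formula (suc k))
  (r' : (Fin k → 𝒮 ℕ) → 𝒮 ℕ → 𝒮 𝕊) (αs : Fin k → 𝒮 ℕ)
  (step : ∀ n → InteractiveRealizer (r' αs (λ _ → n)) ×
                (r' αs (λ _ → n) ⊩ at αs n ∶ (A ⇒ᶠ A[y≔succy] A))) where

  f : ℕ → 𝒮 𝕊
  f = fseq M r' αs

  fseq-realizer : ∀ n → InteractiveRealizer (f n)
  fseq-realizer zero = ⊥-realizer
  fseq-realizer (suc n) = ⊗ˢ-realizer M (fseq-realizer n) (proj₁ (step n))

  fseq-sound : ∀ n s → Prefix (f n) s → Holds A (at αs 0) s → Holds A (at αs n) s
  fseq-sound zero s _ base = base
  fseq-sound (suc n) s prefix base
    with prefix-⊗ M (f n) (r' αs (λ _ → n)) (fseq-realizer n) (proj₁ (step n)) s prefix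
  ... | prefix-f , prefix-r' =
    holds-A[y≔succy] A αs n s
      (holds-⇒ A (A[y≔succy] A) (at αs n) (proj₂ (step n) s prefix-r') (fseq-sound n s prefix-f base))

lemma6p15 : (M : Merge) (k : ℕ) (A : Formula (suc k))
    (r : (Fin k → 𝒮 ℕ) → 𝒮 𝕊)
    (r' : (Fin k → 𝒮 ℕ) → 𝒮 ℕ → 𝒮 𝕊) →
    (∀ αs → (∀ i → Individualℕ (αs i)) →
    InteractiveRealizer (r αs) × (r αs ⊩ αs ∶ A[y≔0] A)) →
    (∀ αs β → (∀ i → Individualℕ (αs i)) → Individualℕ β →
    InteractiveRealizer (r' αs β) × (r' αs β ⊩ env αs β ∶ (A ⇒ᶠ A[y≔succy] A))) →
    ∀ αs β → (∀ i → Individualℕ (αs i)) → Individualℕ β →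
    InteractiveRealizer (fstar M r' αs β) ×
    ((r αs ⊗ˢ[ M ] fstar M r' αs β) ⊩ env αs β ∶ A)
lemma6p15 M k A r r' base step αs β αs-ind β-ind = F-realizer , sound
  where
  open InductionRule M A r' αs (λ n → step αs (λ _ → n) αs-ind (const-individualℕ n))
  F-realizer : InteractiveRealizer (fstar M r' αs β)
  F-realizer = diagonal-realizer f β fseq-realizer β-ind
  sound : (r αs ⊗ˢ[ M ] fstar M r' αs β) ⊩ env αs β ∶ A
  sound s prefix with prefix-⊗ M (r αs) (fstar M r' αs β) (proj₁ (base αs αs-ind)) F-realizer s prefix
  ... | prefix-r , prefix-F =
    holds-local A (at αs (β s)) (env αs β) (λ { fzero → refl ; (fsuc i) → refl })
      (fseq-sound (β s) s prefix-F (holds-A[y≔0] A αs s (proj₂ (base αs αs-ind) s prefix-r)))
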